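{- Let $E$ be a finite-dimensional vector space over a field and let $\mathcal{D}\subseteq\mathcal{L}(E)$ satisfy: (D1) $\{0\}\notin\mathcal{D}$; (D2) if $D_1\in\mathcal{D}$ and $D_1\subseteq D_2$ then $D_2\in\mathcal{D}$; (D3) for all $D_1,D_2\in\mathcal{D}$ with $D_1\cap D_2\notin\mathcal{D}$, every subspace of codimension $1$ in $D_1+D_2$ belongs to $\mathcal{D}$. Then $\mathcal{I}:=\mathcal{L}(E)\setminus\mathcal{D}$ satisfies the independence axioms (I1)–(I4).
   Context: $\mathcal{L}(E)$ is the lattice of subspaces of $E$. Independence axioms: (I1) $\mathcal{I}\ne\emptyset$; (I2) if $J\in\mathcal{I}$ and $I\subseteq J$ then $I\in\mathcal{I}$; (I3) for $I,J\in\mathcal{I}$ with $\dim I<\dim J$ there is a $1$-dimensional $x\subseteq J$, $x\not\subseteq I$, with $I+x\in\mathcal{I}$; (I4) for all subspaces $A,B$ and all inclusion-maximal members $I$ of $\mathcal{I}$ contained in $A$ and $J$ of $\mathcal{I}$ contained in $B$, there is an inclusion-maximal member $K$ of $\mathcal{I}$ contained in $A+B$ with $K\subseteq I+J$. -}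

module Defs where

open import Level using (Level; _⊔_; Lift; lift) renaming (suc to lsuc)
open import Data.Nat using (ℕ; zero; suc; _<_)
open import Data.Fin using (Fin; zero; suc)
open import Data.Product using (Σ; ∃; ∃-syntax; _×_; _,_)
open import Relation.Nullary using (¬_)
open import Algebra.Bundles using (CommutativeRing)

record Field (c ℓ : Level) : Set (lsuc (c ⊔ ℓ)) where
  field
    commutativeRing : CommutativeRing c ℓ
  open CommutativeRing commutativeRing public
  field
    0≉1     : ¬ (0# ≈ 1#)
    inverse : ∀ x → ¬ (x ≈ 0#) → ∃[ y ] (x * y ≈ 1#)

module _ {c ℓ : Level} (F : Field c ℓ) (n : ℕ) where
  open Field F hiding (zero)

  Vect : Set c
  Vect = Fin n → Carrier

  _≈ᵥ_ : Vect → Vect → Set ℓ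
  u ≈ᵥ v = ∀ i → u i ≈ v i

  0ᵥ : Vect
  0ᵥ i = 0#

  _+ᵥ_ : Vect → Vect → Vect
  (u +ᵥ v) i = u i + v i

  _·ᵥ_ : Carrier → Vect → Vect
  (a ·ᵥ v) i = a * v i

  lincomb : ∀ {k} → (Fin k → Carrier) → (Fin k → Vect) → Vect
  lincomb {zero}  a b = 0ᵥ
  lincomb {suc k} a b = (a zero ·ᵥ b zero) +ᵥ lincomb (λ i → a (suc i)) (λ i → b (suc i))

  record Subspace : Set (lsuc (c ⊔ ℓ)) where
    field
      _∋_    : Vect → Set (c ⊔ ℓ)
      resp   : ∀ {u v} → u ≈ᵥ v → _∋_ u → _∋_ v
      ∋0     : _∋_ 0ᵥ
      ∋+     : ∀ {u v} → _∋_ u → _∋_ v → _∋_ (u +ᵥ v)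
      ∋·     : ∀ a {v} → _∋_ v → _∋_ (a ·ᵥ v)
  open Subspace public

  _⊆_ : Subspace → Subspace → Set (c ⊔ ℓ)
  U ⊆ V = ∀ v → U ∋ v → V ∋ v

  zeroSub : Subspace
  zeroSub = record
    { _∋_  = λ v → Lift c (v ≈ᵥ 0ᵥ)
    ; resp = λ {u} {v} u≈v (lift u≈0) → lift λ i → trans (sym (u≈v i)) (u≈0 i)
    ; ∋0   = lift λ i → refl
    ; ∋+   = λ (lift u≈0) (lift v≈0) → lift λ i → trans (+-cong (u≈0 i) (v≈0 i)) (+-identityˡ 0#)
    ; ∋·   = λ a (lift v≈0) → lift λ i → trans (*-congˡ (v≈0 i)) (zeroʳ a)
    }

  _∩_ : Subspace → Subspace → Subspace
  U ∩ V = record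
    { _∋_  = λ v → U ∋ v × V ∋ v
    ; resp = λ eq (p , q) → resp U eq p , resp V eq q
    ; ∋0   = ∋0 U , ∋0 V
    ; ∋+   = λ (p , q) (p' , q') → ∋+ U p p' , ∋+ V q q'
    ; ∋·   = λ a (p , q) → ∋· U a p , ∋· V a q
    }

  _⊕_ : Subspace → Subspace → Subspace
  U ⊕ V = record
    { _∋_  = λ w → ∃[ u ] ∃[ v ] (U ∋ u × V ∋ v × w ≈ᵥ (u +ᵥ v))
    ; resp = λ eq (u , v , p , q , e) → u , v , p , q , (λ i → trans (sym (eq i)) (e i))
    ; ∋0   = 0ᵥ , 0ᵥ , ∋0 U , ∋0 V , (λ i → sym (+-identityˡ 0#))
    ; ∋+   = λ (u , v , p , q , e) (u' , v' , p' , q' , e') →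
               (u +ᵥ u') , (v +ᵥ v') , ∋+ U p p' , ∋+ V q q' ,
               (λ i → trans (+-cong (e i) (e' i)) (+-middle u v u' v' i))
    ; ∋·   = λ a (u , v , p , q , e) →
               (a ·ᵥ u) , (a ·ᵥ v) , ∋· U a p , ∋· V a q ,
               (λ i → trans (*-congˡ (e i)) (distribˡ a (u i) (v i)))
    }
    where
    +-middle : ∀ u v u' v' i → ((u i + v i) + (u' i + v' i)) ≈ ((u i + u' i) + (v i + v' i))
    +-middle u v u' v' i =
      trans (+-assoc (u i) (v i) (u' i + v' i))
     (trans (+-cong refl (trans (sym (+-assoc (v i) (u' i) (v' i)))
                         (trans (+-cong (+-comm (v i) (u' i)) refl)
                                (+-assoc (u' i) (v i) (v' i)))))
            (sym (+-assoc (u i) (u' i) (v i + v' i))))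

  LinIndep : ∀ {k} → (Fin k → Vect) → Set (c ⊔ ℓ)
  LinIndep {k} b = ∀ (a : Fin k → Carrier) → lincomb a b ≈ᵥ 0ᵥ → ∀ i → a i ≈ 0#

  HasDim : Subspace → ℕ → Set (c ⊔ ℓ)
  HasDim U k = ∃[ b ] ((∀ i → U ∋ b i) × LinIndep {k} b ×
                 (∀ v → U ∋ v → ∃[ a ] (v ≈ᵥ lincomb a b)))

  module _ {d : Level} (𝒟 : Subspace → Set d) where

    D1 : Set d
    D1 = ¬ 𝒟 zeroSub

    D2 : Set (lsuc (c ⊔ ℓ) ⊔ d)
    D2 = ∀ D₁ D₂ → 𝒟 D₁ → D₁ ⊆ D₂ → 𝒟 D₂

    D3 : Set (lsuc (c ⊔ ℓ) ⊔ d)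
    D3 = ∀ D₁ D₂ → 𝒟 D₁ → 𝒟 D₂ → ¬ 𝒟 (D₁ ∩ D₂) →
         ∀ H → H ⊆ (D₁ ⊕ D₂) → ∀ m → HasDim H m → HasDim (D₁ ⊕ D₂) (suc m) → 𝒟 H

  module _ {d : Level} (ℐ : Subspace → Set d) where

    MaximalIn : Subspace → Subspace → Set (lsuc (c ⊔ ℓ) ⊔ d)
    MaximalIn A I = ℐ I × I ⊆ A × (∀ K → ℐ K → I ⊆ K → K ⊆ A → K ⊆ I)

    I1 : Set (lsuc (c ⊔ ℓ) ⊔ d)
    I1 = ∃[ I ] ℐ I

    I2 : Set (lsuc (c ⊔ ℓ) ⊔ d)
    I2 = ∀ I J → ℐ J → I ⊆ J → ℐ I

    I3 : Set (lsuc (c ⊔ ℓ) ⊔ d)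
    I3 = ∀ I J → ℐ I → ℐ J → ∀ p q → HasDim I p → HasDim J q → p < q →
         ∃[ x ] (HasDim x 1 × x ⊆ J × ¬ (x ⊆ I) × ℐ (I ⊕ x))

    I4 : Set (lsuc (c ⊔ ℓ) ⊔ d)
    I4 = ∀ A B I J → MaximalIn A I → MaximalIn B J →
         ∃[ K ] (MaximalIn (A ⊕ B) K × K ⊆ (I ⊕ J))

  Complement : ∀ {d} → (Subspace → Set d) → Subspace → Set d
  Complement 𝒟 U = ¬ 𝒟 U

{-# OPTIONS --safe #-}
-- For an independent K, let cl K consist of the vectors v with v ∈ K or K + ⟨v⟩ ∈ 𝒟. By the
-- exchange lemma and (D3), applied to D₁ = K + ⟨u⟩ and D₂ = K + ⟨w⟩ whose intersection is K,
-- cl K is a subspace. (I3) is proved by induction on dim I − dim (I ∩ J): augment a hyperplane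
-- I′ ⊇ I ∩ J of I twice from J and conclude with (D3) once more. By (I3), an independent subspace
-- inside cl K has dimension at most dim K, which makes cl transitive: if I ⊆ cl K is independent
-- and I + ⟨v⟩ is dependent then v ∈ cl K. For (I4), take K maximal independent in I + J; the
-- maximality of I in A and of J in B then puts A + B inside cl K, so K is maximal in A + B.
-- Membership in a subspace is not decidable, so the dimension theory of Fⁿ uses excluded middle.
module Submission where

open import Defs
  using (Field; Subspace; _∋_; resp; ∋0; ∋+; ∋·; D1; D2; D3; I1; I2; I3; I4; MaximalIn; Complement)
open import Level using (Level; _⊔_; Lift; lift; lower) renaming (suc to lsuc)
open import Axiom.ExcludedMiddle using (ExcludedMiddle)
open import Axiom.DoubleNegationElimination using (em⇒dne)
open import Data.Nat as ℕ using (ℕ; zero; suc; _<_; _≤_; s≤s)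
import Data.Nat.Properties as ℕₚ
open import Data.Fin as Fin using (Fin; zero; suc; punchIn; punchOut)
open import Data.Fin.Properties using (punchIn-punchOut)
open import Data.Vec.Functional using (_∷_)
open import Function using (_$_; _∘_)
open import Data.Product using (∃-syntax; _×_; _,_; proj₁; proj₂)
open import Relation.Nullary using (¬_; yes; no; contradiction)
open import Relation.Nullary.Decidable using (map′)
open import Relation.Binary.PropositionalEquality as ≡ using (_≡_)

lower-excluded-middle : ∀ {a} b → ExcludedMiddle (a ⊔ b) → ExcludedMiddle a
lower-excluded-middle b em {P} = map′ lower lift (em {Lift b P})

module HomogeneousSystems {c ℓ} (F : Field c ℓ) (em : ExcludedMiddle ℓ) where
  open Field F hiding (zero)
  open import Algebra.Properties.Ring ring using (-‿distribˡ-*)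
  open import Algebra.Properties.Semiring.Sum semiring
    using (sum; sum-syntax; sum-cong-≋; sum-replicate-zero; ∑-distrib-+; *-distribʳ-sum)
  open import Relation.Binary.Reasoning.Setoid setoid

  NonTrivial : ∀ {k} → (Fin k → Carrier) → Set ℓ
  NonTrivial a = ∃[ i ] ¬ (a i ≈ 0#)

  IsSolution : ∀ {k m} → (Fin k → Carrier) → (Fin k → Fin m → Carrier) → Set ℓ
  IsSolution {k} a b = ∀ t → ∑[ i < k ] (a i * b i t) ≈ 0#

  ≈-stable : ∀ {x y} → ¬ ¬ (x ≈ y) → x ≈ y
  ≈-stable = em⇒dne em

  sum-zero : ∀ {k} (f : Fin k → Carrier) → (∀ i → f i ≈ 0#) → sum f ≈ 0#
  sum-zero {k} f f≈0 = trans (sum-cong-≋ f≈0) (sum-replicate-zero k)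

  δ : ∀ {m} → Fin m → Fin m → Carrier
  δ zero    zero    = 1#
  δ zero    (suc j) = 0#
  δ (suc i) zero    = 0#
  δ (suc i) (suc j) = δ i j

  ∑-δ : ∀ {m} (f : Fin m → Carrier) j → ∑[ i < m ] (f i * δ i j) ≈ f j
  ∑-δ f zero    = trans (+-cong (*-identityʳ _) (sum-zero (λ i → f (suc i) * 0#) (λ i → zeroʳ _)))
                        (+-identityʳ _)
  ∑-δ f (suc j) = trans (+-cong (zeroʳ _) (∑-δ (λ i → f (suc i)) j)) (+-identityˡ _)

  -- Elimination of the first unknown with the pivot b zero j: a solution of the reduced system,
  -- in which equation j has been dropped, lifts to a solution of b.
  module Pivot {k m} (b : Fin (suc k) → Fin (suc m) → Carrier) (j : Fin (suc m))
               (pivot≉0 : ¬ (b zero j ≈ 0#)) where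

    private
      q : Carrier
      q = proj₁ (inverse (b zero j) pivot≉0)

      q*pivot≈1 : q * b zero j ≈ 1#
      q*pivot≈1 = trans (*-comm _ _) (proj₂ (inverse (b zero j) pivot≉0))

      s : Fin k → Carrier
      s i = - (b (suc i) j * q)

      b′ : Fin k → Fin (suc m) → Carrier
      b′ i t = b (suc i) t + s i * b zero t

      b′-pivot≈0 : ∀ i → b′ i j ≈ 0#
      b′-pivot≈0 i = begin
        x + - (x * q) * b zero j   ≈⟨ +-congˡ (-‿distribˡ-* (x * q) (b zero j)) ⟨
        x + - (x * q * b zero j)   ≈⟨ +-congˡ (-‿cong (trans (*-assoc x q _) (*-congˡ q*pivot≈1))) ⟩
        x + - (x * 1#)             ≈⟨ +-congˡ (-‿cong (*-identityʳ x)) ⟩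
        x + - x                    ≈⟨ -‿inverseʳ x ⟩
        0#                         ∎
        where x = b (suc i) j

      factor : ∀ x y z w → x * y * z + x * w ≈ x * (w + y * z)
      factor x y z w = begin
        x * y * z + x * w     ≈⟨ +-congʳ (*-assoc x y z) ⟩
        x * (y * z) + x * w   ≈⟨ distribˡ x (y * z) w ⟨
        x * (y * z + w)       ≈⟨ *-congˡ (+-comm (y * z) w) ⟩
        x * (w + y * z)       ∎

    reduced : Fin k → Fin m → Carrier
    reduced i t = b′ i (punchIn j t)

    lifted : (Fin k → Carrier) → Fin (suc k) → Carrier
    lifted a′ = (∑[ i < k ] (a′ i * s i)) ∷ a′

    lift-solution : ∀ a′ → IsSolution a′ reduced → IsSolution (lifted a′) b
    lift-solution a′ solves t = begin
      (∑[ i < k ] (a′ i * s i)) * b zero t + ∑[ i < k ] (a′ i * b (suc i) t)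
        ≈⟨ +-congʳ (*-distribʳ-sum (b zero t) (λ i → a′ i * s i)) ⟩
      ∑[ i < k ] (a′ i * s i * b zero t) + ∑[ i < k ] (a′ i * b (suc i) t)
        ≈⟨ ∑-distrib-+ (λ i → a′ i * s i * b zero t) (λ i → a′ i * b (suc i) t) ⟨
      ∑[ i < k ] (a′ i * s i * b zero t + a′ i * b (suc i) t)
        ≈⟨ sum-cong-≋ (λ i → factor (a′ i) (s i) (b zero t) (b (suc i) t)) ⟩
      ∑[ i < k ] (a′ i * b′ i t)
        ≈⟨ solves-b′ t ⟩
      0# ∎
      where
      solves-b′ : IsSolution a′ b′
      solves-b′ t with j Fin.≟ t
      ... | yes ≡.refl = sum-zero _ (λ i → trans (*-congˡ (b′-pivot≈0 i)) (zeroʳ _))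
      ... | no j≢t = ≡.subst (λ u → ∑[ i < k ] (a′ i * b′ i u) ≈ 0#)
                       (punchIn-punchOut j≢t) (solves (punchOut j≢t))

  more-unknowns⇒nontrivial-solution : ∀ {k m} → m < k → (b : Fin k → Fin m → Carrier) →
                                      ∃[ a ] (NonTrivial a × IsSolution a b)
  more-unknowns⇒nontrivial-solution {suc k} {m} m<k b with em {∃[ j ] ¬ (b zero j ≈ 0#)}
  ... | no first-row≈0 = (λ i → δ i zero) , (zero , λ 1≈0 → 0≉1 (sym 1≈0)) , solves
    where
    solves : IsSolution (λ i → δ i zero) b
    solves t = begin
      ∑[ i < suc k ] (δ i zero * b i t) ≈⟨ sum-cong-≋ (λ i → *-comm (δ i zero) (b i t)) ⟩
      ∑[ i < suc k ] (b i t * δ i zero) ≈⟨ ∑-δ (λ i → b i t) zero ⟩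
      b zero t                          ≈⟨ ≈-stable (λ b0t≉0 → first-row≈0 (t , b0t≉0)) ⟩
      0#                                ∎
  more-unknowns⇒nontrivial-solution {suc k} {suc m} (s≤s m<k) b | yes (j , pivot≉0)
    with more-unknowns⇒nontrivial-solution m<k (Pivot.reduced b j pivot≉0)
  ... | a′ , (i , a′i≉0) , solves =
    Pivot.lifted b j pivot≉0 a′ , (suc i , a′i≉0) , Pivot.lift-solution b j pivot≉0 a′ solves

module Subspaces {c ℓ} (F : Field c ℓ) (em : ExcludedMiddle (c ⊔ ℓ)) (n : ℕ) where
  open Field F hiding (zero)
  open HomogeneousSystems F (lower-excluded-middle c em)
  open import Algebra.Properties.Ring ring using (-1*x≈-x; +-inverseˡ-unique)
  open import Algebra.Properties.Semiring.Sum semiring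
    using (sum-syntax; sum-cong-≋; ∑-comm; *-distribˡ-sum; *-distribʳ-sum)
  open import Data.Vec.Functional.Relation.Binary.Equality.Setoid setoid
    using (≋-sym; ≋-trans)
  open import Relation.Binary.Reasoning.Setoid setoid

  infix  4 _≈ᵥ_ _⊆_
  infixl 6 _+ᵥ_ _⊕_
  infixr 7 _·ᵥ_
  infixl 7 _∩_

  Vect : Set c
  Vect = Defs.Vect F n

  _≈ᵥ_ : Vect → Vect → Set ℓ
  _≈ᵥ_ = Defs._≈ᵥ_ F n

  0ᵥ : Vect
  0ᵥ = Defs.0ᵥ F n

  _+ᵥ_ : Vect → Vect → Vect
  _+ᵥ_ = Defs._+ᵥ_ F n

  _·ᵥ_ : Carrier → Vect → Vect
  _·ᵥ_ = Defs._·ᵥ_ F n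

  lincomb : ∀ {k} → (Fin k → Carrier) → (Fin k → Vect) → Vect
  lincomb = Defs.lincomb F n

  Sub : Set (lsuc (c ⊔ ℓ))
  Sub = Subspace F n

  -- Inclusion and dimension wrapped in records, so that the subspaces involved can be inferred
  -- from a proof.
  record _⊆_ (U W : Sub) : Set (c ⊔ ℓ) where
    constructor incl
    field mem : ∀ v → U ∋ v → W ∋ v
  open _⊆_ public

  record HasDim (U : Sub) (k : ℕ) : Set (c ⊔ ℓ) where
    constructor hasDim
    field basis : Defs.HasDim F n U k
  open HasDim public

  _⊕_ : Sub → Sub → Sub
  _⊕_ = Defs._⊕_ F n

  _∩_ : Sub → Sub → Sub
  _∩_ = Defs._∩_ F n

  zeroSub : Sub
  zeroSub = Defs.zeroSub F n

  LinIndep : ∀ {k} → (Fin k → Vect) → Set (c ⊔ ℓ)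
  LinIndep = Defs.LinIndep F n

  dne : {A : Set (c ⊔ ℓ)} → ¬ ¬ A → A
  dne = em⇒dne em

  ⟨_⟩ : Vect → Sub
  ⟨ v ⟩ = record
    { _∋_  = λ w → ∃[ a ] (w ≈ᵥ a ·ᵥ v)
    ; resp = λ w≈w′ (a , w≈av) → a , ≋-trans (≋-sym w≈w′) w≈av
    ; ∋0   = 0# , λ i → sym (zeroˡ (v i))
    ; ∋+   = λ (a , p) (b , q) → a + b , λ i → trans (+-cong (p i) (q i)) (sym (distribʳ (v i) a b))
    ; ∋·   = λ x (a , p) → x * a , λ i → trans (*-congˡ (p i)) (sym (*-assoc x a (v i)))
    }

  ∈⟨⟩ : ∀ v → ⟨ v ⟩ ∋ v
  ∈⟨⟩ v = 1# , λ i → sym (*-identityˡ (v i))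

  ⟨⟩-⊆ : ∀ (U : Sub) {v} → U ∋ v → ⟨ v ⟩ ⊆ U
  ⟨⟩-⊆ U v∈U = incl λ w (a , w≈av) → resp U (≋-sym w≈av) (∋· U a v∈U)

  ⊆-refl : ∀ {U} → U ⊆ U
  ⊆-refl = incl λ v v∈U → v∈U

  ⊆-trans : ∀ {U V W} → U ⊆ V → V ⊆ W → U ⊆ W
  ⊆-trans U⊆V V⊆W = incl λ v v∈U → mem V⊆W v (mem U⊆V v v∈U)

  ⊆-⊕ˡ : ∀ A B → A ⊆ A ⊕ B
  ⊆-⊕ˡ A B = incl λ u u∈A → u , 0ᵥ , u∈A , ∋0 B , λ i → sym (+-identityʳ (u i))

  ⊆-⊕ʳ : ∀ A B → B ⊆ A ⊕ B
  ⊆-⊕ʳ A B = incl λ v v∈B → 0ᵥ , v , ∋0 A , v∈B , λ i → sym (+-identityˡ (v i))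

  ⊕-least : ∀ {A B C} → A ⊆ C → B ⊆ C → A ⊕ B ⊆ C
  ⊕-least {C = C} A⊆C B⊆C = incl λ w (u , v , u∈A , v∈B , w≈u+v) →
    resp C (≋-sym w≈u+v) (∋+ C (mem A⊆C u u∈A) (mem B⊆C v v∈B))

  ⊕-mono : ∀ {A B A′ B′} → A ⊆ A′ → B ⊆ B′ → A ⊕ B ⊆ A′ ⊕ B′
  ⊕-mono {A′ = A′} {B′} A⊆A′ B⊆B′ = ⊕-least (⊆-trans A⊆A′ (⊆-⊕ˡ A′ B′)) (⊆-trans B⊆B′ (⊆-⊕ʳ A′ B′))

  ∩-⊆ˡ : ∀ A B → A ∩ B ⊆ A
  ∩-⊆ˡ A B = incl λ v → proj₁

  ∩-⊆ʳ : ∀ A B → A ∩ B ⊆ B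
  ∩-⊆ʳ A B = incl λ v → proj₂

  ⊆-∩ : ∀ {A B C} → C ⊆ A → C ⊆ B → C ⊆ A ∩ B
  ⊆-∩ C⊆A C⊆B = incl λ v v∈C → mem C⊆A v v∈C , mem C⊆B v v∈C

  zeroSub-⊆ : ∀ {U} → zeroSub ⊆ U
  zeroSub-⊆ {U} = incl λ v (lift v≈0) → resp U (≋-sym v≈0) (∋0 U)

  ⊈⇒∃ : ∀ {U W} → ¬ (U ⊆ W) → ∃[ v ] (U ∋ v × ¬ (W ∋ v))
  ⊈⇒∃ U⊈W = dne λ none → U⊈W (incl λ v v∈U → dne λ v∉W → none (v , v∈U , v∉W))

  ∋-·-cancel : ∀ (U : Sub) {a v} → ¬ (a ≈ 0#) → U ∋ (a ·ᵥ v) → U ∋ v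
  ∋-·-cancel U {a} {v} a≉0 av∈U = resp U (λ i → begin
    q * (a * v i) ≈⟨ *-assoc q a (v i) ⟨
    q * a * v i   ≈⟨ *-congʳ (trans (*-comm q a) (proj₂ (inverse a a≉0))) ⟩
    1# * v i      ≈⟨ *-identityˡ (v i) ⟩
    v i           ∎) (∋· U q av∈U)
    where q = proj₁ (inverse a a≉0)

  exchange : ∀ K v {x} → (K ⊕ ⟨ v ⟩) ∋ x → ¬ (K ∋ x) → K ⊕ ⟨ v ⟩ ⊆ K ⊕ ⟨ x ⟩
  exchange K v {x} (k , y , k∈K , (a , y≈av) , x≈k+y) x∉K =
    ⊕-least (⊆-⊕ˡ K ⟨ x ⟩) (⟨⟩-⊆ (K ⊕ ⟨ x ⟩) (∋-·-cancel (K ⊕ ⟨ x ⟩) a≉0 av∈K⊕x))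
    where
    x≈k+av : ∀ i → x i ≈ k i + a * v i
    x≈k+av i = trans (x≈k+y i) (+-congˡ (y≈av i))
    a≉0 : ¬ (a ≈ 0#)
    a≉0 a≈0 = x∉K (resp K (λ i → sym (begin
      x i             ≈⟨ x≈k+av i ⟩
      k i + a * v i   ≈⟨ +-congˡ (trans (*-congʳ a≈0) (zeroˡ (v i))) ⟩
      k i + 0#        ≈⟨ +-identityʳ (k i) ⟩
      k i             ∎)) k∈K)
    av∈K⊕x : (K ⊕ ⟨ x ⟩) ∋ (a ·ᵥ v)
    av∈K⊕x = (- 1#) ·ᵥ k , x , ∋· K (- 1#) k∈K , ∈⟨⟩ x , λ i → sym (begin
      - 1# * k i + x i             ≈⟨ +-cong (-1*x≈-x (k i)) (x≈k+av i) ⟩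
      - k i + (k i + a * v i)      ≈⟨ +-assoc _ _ _ ⟨
      (- k i + k i) + a * v i      ≈⟨ +-congʳ (-‿inverseˡ (k i)) ⟩
      0# + a * v i                 ≈⟨ +-identityˡ _ ⟩
      a * v i                      ∎)

  ⊕⟨⟩∩⊕⟨⟩-⊆ : ∀ {K u w} → ¬ ((K ⊕ ⟨ u ⟩) ∋ w) → (K ⊕ ⟨ u ⟩) ∩ (K ⊕ ⟨ w ⟩) ⊆ K
  ⊕⟨⟩∩⊕⟨⟩-⊆ {K} {u} {w} w∉K⊕u = incl λ y (y∈K⊕u , y∈K⊕w) → dne λ y∉K →
    w∉K⊕u (mem (⊆-trans (exchange K w y∈K⊕w y∉K) (⊕-least (⊆-⊕ˡ K ⟨ u ⟩) (⟨⟩-⊆ (K ⊕ ⟨ u ⟩) {y} y∈K⊕u)))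
               w (mem (⊆-⊕ʳ K ⟨ w ⟩) w (∈⟨⟩ w)))

  lincomb-coordinate : ∀ {k} (a : Fin k → Carrier) (b : Fin k → Vect) t →
                       lincomb a b t ≡ ∑[ i < k ] (a i * b i t)
  lincomb-coordinate {zero}  a b t = ≡.refl
  lincomb-coordinate {suc k} a b t =
    ≡.cong (a zero * b zero t +_) (lincomb-coordinate (λ i → a (suc i)) (λ i → b (suc i)) t)

  lincomb-∈ : ∀ (U : Sub) {k} (a : Fin k → Carrier) (b : Fin k → Vect) → (∀ i → U ∋ b i) → U ∋ lincomb a b
  lincomb-∈ U {zero}  a b b∈U = ∋0 U
  lincomb-∈ U {suc k} a b b∈U =
    ∋+ U (∋· U (a zero) (b∈U zero)) (lincomb-∈ U (λ i → a (suc i)) (λ i → b (suc i)) (λ i → b∈U (suc i)))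

  -- For q < p, a nontrivial relation among the coordinate vectors α i ∈ Fᵠ is one among the u i.
  independent-in-span⇒≤ : ∀ {p q} {u : Fin p → Vect} {v : Fin q → Vect} → LinIndep u →
                          (∀ i → ∃[ α ] (u i ≈ᵥ lincomb α v)) → p ≤ q
  independent-in-span⇒≤ {p} {q} {u} {v} indep spans with q ℕ.<? p
  ... | no q≮p = ℕₚ.≮⇒≥ q≮p
  ... | yes q<p with more-unknowns⇒nontrivial-solution q<p (λ i → proj₁ (spans i))
  ...   | a , (i , aᵢ≉0) , solves = contradiction (indep a combination≈0 i) aᵢ≉0
    where
    α : Fin p → Fin q → Carrier
    α i = proj₁ (spans i)
    combination≈0 : lincomb a u ≈ᵥ 0ᵥ
    combination≈0 s = begin
      lincomb a u s                                 ≡⟨ lincomb-coordinate a u s ⟩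
      ∑[ i < p ] (a i * u i s)                      ≈⟨ sum-cong-≋ (λ i → *-congˡ (u≈ i)) ⟩
      ∑[ i < p ] (a i * ∑[ t < q ] (α i t * v t s)) ≈⟨ sum-cong-≋ (λ i → *-distribˡ-sum (a i) (α·v i)) ⟩
      ∑[ i < p ] ∑[ t < q ] (a i * (α i t * v t s)) ≈⟨ ∑-comm (λ i t → a i * (α i t * v t s)) ⟩
      ∑[ t < q ] ∑[ i < p ] (a i * (α i t * v t s)) ≈⟨ sum-cong-≋ (λ t → regroup t) ⟩
      ∑[ t < q ] (∑[ i < p ] (a i * α i t) * v t s) ≈⟨ sum-zero _ (λ t → vanishes t) ⟩
      0#                                            ∎
      where
      α·v : Fin p → Fin q → Carrier
      α·v i t = α i t * v t s
      u≈ : ∀ i → u i s ≈ ∑[ t < q ] (α i t * v t s)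
      u≈ i = trans (proj₂ (spans i) s) (reflexive (lincomb-coordinate (α i) v s))
      regroup : ∀ t → ∑[ i < p ] (a i * (α i t * v t s)) ≈ ∑[ i < p ] (a i * α i t) * v t s
      regroup t = trans (sum-cong-≋ (λ i → sym (*-assoc (a i) (α i t) (v t s))))
                        (sym (*-distribʳ-sum (v t s) (λ i → a i * α i t)))
      vanishes : ∀ t → ∑[ i < p ] (a i * α i t) * v t s ≈ 0#
      vanishes t = trans (*-congʳ (solves t)) (zeroˡ (v t s))

  HasDim⇒≤n : ∀ {U k} → HasDim U k → k ≤ n
  HasDim⇒≤n (hasDim (b , _ , indep , _)) = independent-in-span⇒≤ indep λ i →
    b i , λ t → sym (trans (reflexive (lincomb-coordinate (b i) (λ j → δ j) t)) (∑-δ (b i) t))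

  HasDim-mono : ∀ {U W p q} → U ⊆ W → HasDim U p → HasDim W q → p ≤ q
  HasDim-mono U⊆W (hasDim (b , b∈U , indep , _)) (hasDim (_ , _ , _ , spans)) =
    independent-in-span⇒≤ indep λ i → spans (b i) (mem U⊆W (b i) (b∈U i))

  HasDim-cong : ∀ {U W k} → U ⊆ W → W ⊆ U → HasDim U k → HasDim W k
  HasDim-cong U⊆W W⊆U (hasDim (b , b∈U , indep , spans)) = hasDim $
    b , (λ i → mem U⊆W (b i) (b∈U i)) , indep , λ v v∈W → spans v (mem W⊆U v v∈W)

  HasDim-zeroSub : HasDim zeroSub 0
  HasDim-zeroSub = hasDim $ (λ ()) , (λ ()) , (λ _ _ ()) , λ v (lift v≈0) → (λ ()) , v≈0

  HasDim-⊕⟨⟩ : ∀ {W k v} → HasDim W k → ¬ (W ∋ v) → HasDim (W ⊕ ⟨ v ⟩) (suc k)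
  HasDim-⊕⟨⟩ {W} {k} {v} (hasDim (b , b∈W , indep , spans)) v∉W = hasDim $ v ∷ b , v∷b∈W⊕v , indep′ , spans′
    where
    v∷b∈W⊕v : ∀ i → (W ⊕ ⟨ v ⟩) ∋ (v ∷ b) i
    v∷b∈W⊕v zero    = mem (⊆-⊕ʳ W ⟨ v ⟩) v (∈⟨⟩ v)
    v∷b∈W⊕v (suc i) = mem (⊆-⊕ˡ W ⟨ v ⟩) (b i) (b∈W i)

    indep′ : LinIndep (v ∷ b)
    indep′ a a·v∷b≈0 = coefficients≈0
      where
      rest : Vect
      rest = lincomb (λ i → a (suc i)) b
      a₀v∈W : W ∋ (a zero ·ᵥ v)
      a₀v∈W = resp W (λ i → trans (-1*x≈-x (rest i)) (sym (+-inverseˡ-unique _ _ (a·v∷b≈0 i))))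
                     (∋· W (- 1#) (lincomb-∈ W _ b b∈W))
      a₀≈0 : a zero ≈ 0#
      a₀≈0 = ≈-stable λ a₀≉0 → v∉W (∋-·-cancel W a₀≉0 a₀v∈W)
      coefficients≈0 : ∀ i → a i ≈ 0#
      coefficients≈0 zero    = a₀≈0
      coefficients≈0 (suc i) = indep (λ i → a (suc i)) rest≈0 i
        where
        rest≈0 : rest ≈ᵥ 0ᵥ
        rest≈0 j = begin
          rest j                  ≈⟨ +-identityˡ (rest j) ⟨
          0# + rest j             ≈⟨ +-congʳ (trans (*-congʳ a₀≈0) (zeroˡ (v j))) ⟨
          a zero * v j + rest j   ≈⟨ a·v∷b≈0 j ⟩
          0#                      ∎

    spans′ : ∀ w → (W ⊕ ⟨ v ⟩) ∋ w → ∃[ a ] (w ≈ᵥ lincomb a (v ∷ b))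
    spans′ w (u , x , u∈W , (β , x≈βv) , w≈u+x) with spans u u∈W
    ... | α , u≈αb = β ∷ α , λ j → trans (w≈u+x j) (trans (+-cong (u≈αb j) (x≈βv j)) (+-comm _ _))

  HasDim-⟨⟩ : ∀ {v} → ¬ (v ≈ᵥ 0ᵥ) → HasDim ⟨ v ⟩ 1
  HasDim-⟨⟩ {v} v≉0 = HasDim-cong (⊕-least zeroSub-⊆ ⊆-refl) (⊆-⊕ʳ zeroSub ⟨ v ⟩)
                                  (HasDim-⊕⟨⟩ HasDim-zeroSub (λ (lift v≈0) → v≉0 v≈0))

  HasDim-≡⇒⊇ : ∀ {U W k} → U ⊆ W → HasDim U k → HasDim W k → W ⊆ U
  HasDim-≡⇒⊇ {U} {W} U⊆W dimU dimW = incl λ v v∈W → dne λ v∉U →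
    ℕₚ.<-irrefl ≡.refl (HasDim-mono (⊕-least U⊆W (⟨⟩-⊆ W v∈W)) (HasDim-⊕⟨⟩ dimU v∉U) dimW)

  extend-inside : ∀ {W U k} → W ⊆ U → HasDim W k → ¬ (U ⊆ W) →
                  ∃[ W′ ] (W ⊆ W′ × W′ ⊆ U × HasDim W′ (suc k))
  extend-inside {W} {U} W⊆U dimW U⊈W with ⊈⇒∃ U⊈W
  ... | v , v∈U , v∉W = W ⊕ ⟨ v ⟩ , ⊆-⊕ˡ W ⟨ v ⟩ , ⊕-least W⊆U (⟨⟩-⊆ U v∈U) , HasDim-⊕⟨⟩ dimW v∉W

  HasDim-n⇒∋ : ∀ {W} → HasDim W n → ∀ v → W ∋ v
  HasDim-n⇒∋ {W} dimW v = dne λ v∉W → ℕₚ.<-irrefl ≡.refl (HasDim⇒≤n (HasDim-⊕⟨⟩ dimW v∉W))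

  dimension : ∀ U → ∃[ k ] HasDim U k
  dimension U = grow n zeroSub-⊆ HasDim-zeroSub (ℕₚ.+-identityʳ n)
    where
    grow : ∀ t {W k} → W ⊆ U → HasDim W k → t ℕ.+ k ≡ n → ∃[ k ] HasDim U k
    grow zero W⊆U dimW ≡.refl = n , HasDim-cong W⊆U (incl λ v _ → HasDim-n⇒∋ dimW v) dimW
    grow (suc t) {W} {k} W⊆U dimW t+k≡n with em {U ⊆ W}
    ... | yes U⊆W = k , HasDim-cong W⊆U U⊆W dimW
    ... | no U⊈W with extend-inside W⊆U dimW U⊈W
    ...   | _ , _ , W′⊆U , dimW′ = grow t W′⊆U dimW′ (≡.trans (ℕₚ.+-suc t k) t+k≡n)

  hyperplane-between : ∀ t {W U k p} → W ⊆ U → HasDim W k → HasDim U (suc p) → t ℕ.+ k ≡ p →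
                       ∃[ H ] (W ⊆ H × H ⊆ U × HasDim H p)
  hyperplane-between zero {W} W⊆U dimW _ ≡.refl = W , ⊆-refl , W⊆U , dimW
  hyperplane-between (suc t) {W} {U} {k} W⊆U dimW dimU t+k≡p with em {U ⊆ W}
  ... | yes U⊆W = contradiction (HasDim-mono U⊆W dimU dimW)
                    (ℕₚ.<⇒≱ (s≤s (ℕₚ.≤-trans (ℕₚ.m≤n+m k (suc t)) (ℕₚ.≤-reflexive t+k≡p))))
  ... | no U⊈W with extend-inside W⊆U dimW U⊈W
  ...   | W′ , W⊆W′ , W′⊆U , dimW′ with hyperplane-between t W′⊆U dimW′ dimU (≡.trans (ℕₚ.+-suc t k) t+k≡p)
  ...     | H , W′⊆H , H⊆U , dimH = H , ⊆-trans W⊆W′ W′⊆H , H⊆U , dimH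

module Matroid {c ℓ d} (em : ExcludedMiddle (c ⊔ ℓ ⊔ d)) (F : Field c ℓ) (n : ℕ)
               (𝒟 : Subspace F n → Set d) (d1 : D1 F n 𝒟) (d2 : D2 F n 𝒟) (d3 : D3 F n 𝒟) where
  open Field F hiding (zero)
  open Subspaces F (lower-excluded-middle d em) n
  open import Data.Vec.Functional.Relation.Binary.Equality.Setoid setoid using (≋-sym)

  ℐ : Sub → Set d
  ℐ = Complement F n 𝒟

  em-ℓ : ExcludedMiddle (c ⊔ ℓ)
  em-ℓ = lower-excluded-middle d em

  𝒟-stable : ∀ {U} → ¬ ¬ 𝒟 U → 𝒟 U
  𝒟-stable = em⇒dne (lower-excluded-middle (c ⊔ ℓ) em)

  𝒟-mono : ∀ {A B} → 𝒟 A → A ⊆ B → 𝒟 B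
  𝒟-mono {A} {B} 𝒟A A⊆B = d2 A B 𝒟A (mem A⊆B)

  ℐ-anti : ∀ {A B} → ℐ B → A ⊆ B → ℐ A
  ℐ-anti ℐB A⊆B 𝒟A = ℐB (𝒟-mono 𝒟A A⊆B)

  𝒟⊕⟨⟩⇒∉ : ∀ {K u} → ℐ K → 𝒟 (K ⊕ ⟨ u ⟩) → ¬ (K ∋ u)
  𝒟⊕⟨⟩⇒∉ {K} {u} ℐK 𝒟K⊕u u∈K = ℐK (𝒟-mono 𝒟K⊕u (⊕-least ⊆-refl (⟨⟩-⊆ K u∈K)))

  -- (D3) for D₁ = K + ⟨u⟩ and D₂ = K + ⟨w⟩, whose intersection is K.
  D3-lines : ∀ {K k u w H} → ℐ K → HasDim K k → 𝒟 (K ⊕ ⟨ u ⟩) → 𝒟 (K ⊕ ⟨ w ⟩) → ¬ ((K ⊕ ⟨ u ⟩) ∋ w) →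
             H ⊆ K ⊕ ⟨ u ⟩ ⊕ ⟨ w ⟩ → HasDim H (suc k) → 𝒟 H
  D3-lines {K} {k} {u} {w} {H} ℐK dimK 𝒟D₁ 𝒟D₂ w∉D₁ H⊆T dimH =
    d3 D₁ D₂ 𝒟D₁ 𝒟D₂ (ℐ-anti ℐK (⊕⟨⟩∩⊕⟨⟩-⊆ w∉D₁)) H (mem (⊆-trans H⊆T T⊆D₁⊕D₂)) (suc k)
       (basis dimH) (basis (HasDim-cong T⊆D₁⊕D₂ D₁⊕D₂⊆T (HasDim-⊕⟨⟩ (HasDim-⊕⟨⟩ dimK u∉K) w∉D₁)))
    where
    D₁ D₂ T : Sub
    D₁ = K ⊕ ⟨ u ⟩
    D₂ = K ⊕ ⟨ w ⟩
    T  = D₁ ⊕ ⟨ w ⟩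
    u∉K : ¬ (K ∋ u)
    u∉K = 𝒟⊕⟨⟩⇒∉ ℐK 𝒟D₁
    T⊆D₁⊕D₂ : T ⊆ D₁ ⊕ D₂
    T⊆D₁⊕D₂ = ⊕-mono (⊆-refl {D₁}) (⊆-⊕ʳ K ⟨ w ⟩)
    D₁⊕D₂⊆T : D₁ ⊕ D₂ ⊆ T
    D₁⊕D₂⊆T = ⊕-least (⊆-⊕ˡ D₁ ⟨ w ⟩) (⊕-least (⊆-trans (⊆-⊕ˡ K ⟨ u ⟩) (⊆-⊕ˡ D₁ ⟨ w ⟩)) (⊆-⊕ʳ D₁ ⟨ w ⟩))

  data cl (K : Sub) (v : Vect) : Set (c ⊔ ℓ ⊔ d) where
    member    : K ∋ v → cl K v
    dependent : 𝒟 (K ⊕ ⟨ v ⟩) → cl K v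

  infix 4 _⊆ᵖ_
  record _⊆ᵖ_ (U : Sub) (S : Vect → Set (c ⊔ ℓ ⊔ d)) : Set (c ⊔ ℓ ⊔ d) where
    constructor inclᵖ
    field memᵖ : ∀ v → U ∋ v → S v
  open _⊆ᵖ_

  ⊆ᵖ-trans : ∀ {U W S} → U ⊆ W → W ⊆ᵖ S → U ⊆ᵖ S
  ⊆ᵖ-trans U⊆W W⊆S = inclᵖ λ v v∈U → memᵖ W⊆S v (mem U⊆W v v∈U)

  cl-⊕⟨⟩ : ∀ K u {x} → 𝒟 (K ⊕ ⟨ u ⟩) → (K ⊕ ⟨ u ⟩) ∋ x → cl K x
  cl-⊕⟨⟩ K u {x} 𝒟K⊕u x∈K⊕u with em-ℓ {K ∋ x}
  ... | yes x∈K = member x∈K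
  ... | no x∉K  = dependent (𝒟-mono 𝒟K⊕u (exchange K u x∈K⊕u x∉K))

  ⟨⟩-⊆cl : ∀ {K v} → cl K v → ⟨ v ⟩ ⊆ᵖ cl K
  ⟨⟩-⊆cl {K}     (member v∈K)     = inclᵖ λ x x∈⟨v⟩ → member (mem (⟨⟩-⊆ K v∈K) x x∈⟨v⟩)
  ⟨⟩-⊆cl {K} {v} (dependent 𝒟K⊕v) = inclᵖ λ x x∈⟨v⟩ → cl-⊕⟨⟩ K v 𝒟K⊕v (mem (⊆-⊕ʳ K ⟨ v ⟩) x x∈⟨v⟩)

  cl-+ : ∀ {K u w} → ℐ K → cl K u → cl K w → cl K (u +ᵥ w)
  cl-+ {K} ℐK (member u∈K) (member w∈K) = member (∋+ K u∈K w∈K)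
  cl-+ {K} {u} {w} ℐK (member u∈K) (dependent 𝒟K⊕w) =
    cl-⊕⟨⟩ K w 𝒟K⊕w (∋+ (K ⊕ ⟨ w ⟩) (mem (⊆-⊕ˡ K ⟨ w ⟩) u u∈K) (mem (⊆-⊕ʳ K ⟨ w ⟩) w (∈⟨⟩ w)))
  cl-+ {K} {u} {w} ℐK (dependent 𝒟K⊕u) (member w∈K) =
    cl-⊕⟨⟩ K u 𝒟K⊕u (∋+ (K ⊕ ⟨ u ⟩) (mem (⊆-⊕ʳ K ⟨ u ⟩) u (∈⟨⟩ u)) (mem (⊆-⊕ˡ K ⟨ u ⟩) w w∈K))
  cl-+ {K} {u} {w} ℐK (dependent 𝒟K⊕u) (dependent 𝒟K⊕w) with em-ℓ {(K ⊕ ⟨ u ⟩) ∋ w} | em-ℓ {K ∋ (u +ᵥ w)}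
  ... | yes w∈K⊕u | _ = cl-⊕⟨⟩ K u 𝒟K⊕u (∋+ (K ⊕ ⟨ u ⟩) (mem (⊆-⊕ʳ K ⟨ u ⟩) u (∈⟨⟩ u)) w∈K⊕u)
  ... | no _ | yes u+w∈K = member u+w∈K
  ... | no w∉K⊕u | no u+w∉K with dimension K
  ...   | k , dimK = dependent (D3-lines ℐK dimK 𝒟K⊕u 𝒟K⊕w w∉K⊕u K⊕u+w⊆T (HasDim-⊕⟨⟩ dimK u+w∉K))
    where
    T : Sub
    T = K ⊕ ⟨ u ⟩ ⊕ ⟨ w ⟩
    u+w∈T : T ∋ (u +ᵥ w)
    u+w∈T = ∋+ T (mem (⊆-trans (⊆-⊕ʳ K ⟨ u ⟩) (⊆-⊕ˡ (K ⊕ ⟨ u ⟩) ⟨ w ⟩)) u (∈⟨⟩ u))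
                 (mem (⊆-⊕ʳ (K ⊕ ⟨ u ⟩) ⟨ w ⟩) w (∈⟨⟩ w))
    K⊕u+w⊆T : K ⊕ ⟨ u +ᵥ w ⟩ ⊆ T
    K⊕u+w⊆T = ⊕-least (⊆-trans (⊆-⊕ˡ K ⟨ u ⟩) (⊆-⊕ˡ (K ⊕ ⟨ u ⟩) ⟨ w ⟩)) (⟨⟩-⊆ T u+w∈T)

  ⊕-⊆cl : ∀ {K A B} → ℐ K → A ⊆ᵖ cl K → B ⊆ᵖ cl K → A ⊕ B ⊆ᵖ cl K
  ⊕-⊆cl {K} ℐK A⊆clK B⊆clK = inclᵖ λ w (u , v , u∈A , v∈B , w≈u+v) →
    memᵖ (⟨⟩-⊆cl (cl-+ ℐK (memᵖ A⊆clK u u∈A) (memᵖ B⊆clK v v∈B))) w (resp ⟨ u +ᵥ v ⟩ (≋-sym w≈u+v) (∈⟨⟩ _))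

  Augmentable : Sub → Sub → Set (c ⊔ ℓ ⊔ d)
  Augmentable I J = ∃[ e ] (J ∋ e × ¬ (I ∋ e) × ℐ (I ⊕ ⟨ e ⟩))

  augment-⊆ : ∀ {I J p q} → ℐ J → I ⊆ J → HasDim I p → HasDim J q → p < q → Augmentable I J
  augment-⊆ {I} {J} ℐJ I⊆J dimI dimJ p<q with ⊈⇒∃ (λ J⊆I → ℕₚ.<⇒≱ p<q (HasDim-mono J⊆I dimJ dimI))
  ... | e , e∈J , e∉I = e , e∈J , e∉I , ℐ-anti ℐJ (⊕-least I⊆J (⟨⟩-⊆ J e∈J))

  ⊈⇒dim∩< : ∀ {I J p r} → ¬ (I ⊆ J) → HasDim I p → HasDim (I ∩ J) r → r < p
  ⊈⇒dim∩< {I} {J} {p} {r} I⊈J dimI dimI∩J with r ℕ.<? p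
  ... | yes r<p = r<p
  ... | no r≮p = contradiction (⊆-trans I⊆I∩J (∩-⊆ʳ I J)) I⊈J
    where
    r≡p : r ≡ p
    r≡p = ℕₚ.≤-antisym (HasDim-mono (∩-⊆ˡ I J) dimI∩J dimI) (ℕₚ.≮⇒≥ r≮p)
    I⊆I∩J : I ⊆ I ∩ J
    I⊆I∩J = HasDim-≡⇒⊇ (∩-⊆ˡ I J) dimI∩J (≡.subst (HasDim I) (≡.sym r≡p) dimI)

  -- If I cannot be augmented from J, then I + ⟨e₁⟩ and I + ⟨e₂⟩ are dependent, and (D3), or a
  -- dimension count when e₂ ∈ I + ⟨e₁⟩, makes I′ + ⟨e₁⟩ + ⟨e₂⟩ dependent as well.
  augment-via-hyperplane : ∀ {I J I′ p e₁} → ℐ I → HasDim I (suc p) → I′ ⊆ I → I ∩ J ⊆ I′ → HasDim I′ p →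
                           J ∋ e₁ → ¬ (I′ ∋ e₁) → Augmentable (I′ ⊕ ⟨ e₁ ⟩) J → Augmentable I J
  augment-via-hyperplane {I} {J} {I′} {p} {e₁} ℐI dimI I′⊆I I∩J⊆I′ dimI′ e₁∈J e₁∉I′ (e₂ , e₂∈J , e₂∉I″ , ℐH) =
    em⇒dne em λ ¬aug → ℐH (𝒟H ¬aug)
    where
    I″ H : Sub
    I″ = I′ ⊕ ⟨ e₁ ⟩
    H  = I″ ⊕ ⟨ e₂ ⟩
    ∉I : ∀ {e} → J ∋ e → ¬ (I′ ∋ e) → ¬ (I ∋ e)
    ∉I {e} e∈J e∉I′ e∈I = e∉I′ (mem I∩J⊆I′ e (e∈I , e∈J))
    e₁∉I : ¬ (I ∋ e₁)
    e₁∉I = ∉I e₁∈J e₁∉I′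
    e₂∉I : ¬ (I ∋ e₂)
    e₂∉I = ∉I e₂∈J (λ e₂∈I′ → e₂∉I″ (mem (⊆-⊕ˡ I′ ⟨ e₁ ⟩) e₂ e₂∈I′))
    dimH : HasDim H (suc (suc p))
    dimH = HasDim-⊕⟨⟩ (HasDim-⊕⟨⟩ dimI′ e₁∉I′) e₂∉I″
    I″⊆I⊕e₁ : I″ ⊆ I ⊕ ⟨ e₁ ⟩
    I″⊆I⊕e₁ = ⊕-mono I′⊆I (⊆-refl {⟨ e₁ ⟩})
    𝒟I⊕ : ¬ Augmentable I J → ∀ {e} → J ∋ e → ¬ (I ∋ e) → 𝒟 (I ⊕ ⟨ e ⟩)
    𝒟I⊕ ¬aug {e} e∈J e∉I = 𝒟-stable λ ℐI⊕e → ¬aug (e , e∈J , e∉I , ℐI⊕e)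
    𝒟H : ¬ Augmentable I J → 𝒟 H
    𝒟H ¬aug with em-ℓ {(I ⊕ ⟨ e₁ ⟩) ∋ e₂}
    ... | yes e₂∈I⊕e₁ = 𝒟-mono (𝒟I⊕ ¬aug e₁∈J e₁∉I)
                          (HasDim-≡⇒⊇ (⊕-least I″⊆I⊕e₁ (⟨⟩-⊆ (I ⊕ ⟨ e₁ ⟩) e₂∈I⊕e₁)) dimH
                                      (HasDim-⊕⟨⟩ dimI e₁∉I))
    ... | no e₂∉I⊕e₁ = D3-lines ℐI dimI (𝒟I⊕ ¬aug e₁∈J e₁∉I) (𝒟I⊕ ¬aug e₂∈J e₂∉I) e₂∉I⊕e₁
                         (⊕-mono I″⊆I⊕e₁ (⊆-refl {⟨ e₂ ⟩})) dimH

  gap-shrinks : ∀ {p r t r′} → suc p ≤ r ℕ.+ suc t → r ≤ r′ → p ≤ r′ ℕ.+ t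
  gap-shrinks {p} {r} {t} gap r≤r′ =
    ℕₚ.≤-trans (ℕₚ.≤-pred (ℕₚ.≤-trans gap (ℕₚ.≤-reflexive (ℕₚ.+-suc r t)))) (ℕₚ.+-monoˡ-≤ t r≤r′)

  gap-shrinks-suc : ∀ {p r t r″} → suc p ≤ r ℕ.+ suc t → suc r ≤ r″ → suc p ≤ r″ ℕ.+ t
  gap-shrinks-suc {p} {r} {t} gap r<r″ =
    ℕₚ.≤-trans (ℕₚ.≤-trans gap (ℕₚ.≤-reflexive (ℕₚ.+-suc r t))) (ℕₚ.+-monoˡ-≤ t r<r″)

  -- t bounds the gap dim I − dim (I ∩ J), the induction measure for (I3).
  AugmentsWithGap : ℕ → Sub → ℕ → Set (lsuc (c ⊔ ℓ) ⊔ d)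
  AugmentsWithGap t J q = ∀ {I p r} → ℐ I → HasDim I p → p < q → HasDim (I ∩ J) r → p ≤ r ℕ.+ t →
                          Augmentable I J

  augment-step : ∀ {J q t} → AugmentsWithGap t J q → ∀ {I p r} → ℐ I → HasDim I (suc p) → suc p < q →
                 HasDim (I ∩ J) r → r ≤ p → suc p ≤ r ℕ.+ suc t → Augmentable I J
  augment-step {J} {q} {t} augments {I} {p} {r} ℐI dimI p<q dimI∩J r≤p gap
    with hyperplane-between (p ℕ.∸ r) (∩-⊆ˡ I J) dimI∩J dimI (ℕₚ.m∸n+n≡m r≤p)
  ... | I′ , I∩J⊆I′ , I′⊆I , dimI′ with dimension (I′ ∩ J)
  ... | r′ , dimI′∩J with augments (ℐ-anti ℐI I′⊆I) dimI′ (ℕₚ.<-trans (ℕₚ.n<1+n p) p<q) dimI′∩J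
                            (gap-shrinks gap (HasDim-mono (⊆-∩ I∩J⊆I′ (∩-⊆ʳ I J)) dimI∩J dimI′∩J))
  ... | e₁ , e₁∈J , e₁∉I′ , ℐI′⊕e₁ with dimension ((I′ ⊕ ⟨ e₁ ⟩) ∩ J)
  ... | r″ , dimI″∩J = augment-via-hyperplane ℐI dimI I′⊆I I∩J⊆I′ dimI′ e₁∈J e₁∉I′
                         (augments ℐI′⊕e₁ (HasDim-⊕⟨⟩ dimI′ e₁∉I′) p<q dimI″∩J (gap-shrinks-suc gap r<r″))
    where
    I∩J⊕e₁⊆I″∩J : (I ∩ J) ⊕ ⟨ e₁ ⟩ ⊆ (I′ ⊕ ⟨ e₁ ⟩) ∩ J
    I∩J⊕e₁⊆I″∩J = ⊕-least (⊆-∩ (⊆-trans I∩J⊆I′ (⊆-⊕ˡ I′ ⟨ e₁ ⟩)) (∩-⊆ʳ I J))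
                          (⊆-∩ (⊆-⊕ʳ I′ ⟨ e₁ ⟩) (⟨⟩-⊆ J e₁∈J))
    r<r″ : suc r ≤ r″
    r<r″ = HasDim-mono I∩J⊕e₁⊆I″∩J (HasDim-⊕⟨⟩ dimI∩J (λ e₁∈I∩J → e₁∉I′ (mem I∩J⊆I′ e₁ e₁∈I∩J))) dimI″∩J

  augment : ∀ {J q} → ℐ J → HasDim J q → ∀ t → AugmentsWithGap t J q
  augment {J} ℐJ dimJ t {I} {p} {r} ℐI dimI p<q dimI∩J gap with em-ℓ {I ⊆ J}
  ... | yes I⊆J = augment-⊆ ℐJ I⊆J dimI dimJ p<q
  ... | no I⊈J with ⊈⇒dim∩< I⊈J dimI dimI∩J | t
  ...   | r<p | zero = contradiction (ℕₚ.≤-trans gap (ℕₚ.≤-reflexive (ℕₚ.+-identityʳ r))) (ℕₚ.<⇒≱ r<p)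
  ...   | s≤s r≤p | suc t′ = augment-step (augment ℐJ dimJ t′) ℐI dimI p<q dimI∩J r≤p gap

  augment-from-larger : ∀ {I J p q} → ℐ I → ℐ J → HasDim I p → HasDim J q → p < q → Augmentable I J
  augment-from-larger {I} {J} {p} ℐI ℐJ dimI dimJ p<q with dimension (I ∩ J)
  ... | r , dimI∩J = augment ℐJ dimJ p ℐI dimI p<q dimI∩J (ℕₚ.m≤n+m p r)

  ⊆cl⇒¬Augmentable : ∀ {I J} → J ⊆ᵖ cl I → ¬ Augmentable I J
  ⊆cl⇒¬Augmentable J⊆clI (e , e∈J , e∉I , ℐI⊕e) with memᵖ J⊆clI e e∈J
  ... | member e∈I     = e∉I e∈I
  ... | dependent 𝒟I⊕e = ℐI⊕e 𝒟I⊕e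

  ⊆cl⇒dim≤ : ∀ {I J p q} → ℐ I → ℐ J → J ⊆ᵖ cl I → HasDim I p → HasDim J q → q ≤ p
  ⊆cl⇒dim≤ ℐI ℐJ J⊆clI dimI dimJ =
    ℕₚ.≮⇒≥ λ p<q → ⊆cl⇒¬Augmentable J⊆clI (augment-from-larger ℐI ℐJ dimI dimJ p<q)

  cl-mono : ∀ {I K v} → I ⊆ K → 𝒟 (I ⊕ ⟨ v ⟩) → cl K v
  cl-mono {I} {K} {v} I⊆K 𝒟I⊕v with em-ℓ {K ∋ v}
  ... | yes v∈K = member v∈K
  ... | no _    = dependent (𝒟-mono 𝒟I⊕v (⊕-mono I⊆K (⊆-refl {⟨ v ⟩})))

  MaximalWithin : (Vect → Set (c ⊔ ℓ ⊔ d)) → Sub → Set (c ⊔ ℓ ⊔ d)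
  MaximalWithin S K = K ⊆ᵖ S × ℐ K × (∀ v → S v → cl K v)

  LineClosed : (Vect → Set (c ⊔ ℓ ⊔ d)) → Set (lsuc (c ⊔ ℓ) ⊔ d)
  LineClosed S = ∀ {K v} → K ⊆ᵖ S → S v → K ⊕ ⟨ v ⟩ ⊆ᵖ S

  cl-lineClosed : ∀ {K} → ℐ K → LineClosed (cl K)
  cl-lineClosed ℐK U⊆clK v∈clK = ⊕-⊆cl ℐK U⊆clK (⟨⟩-⊆cl v∈clK)

  extend-to-maximal : ∀ {S} → LineClosed S → ∀ {K₀} → ℐ K₀ → K₀ ⊆ᵖ S → ∃[ K ] (K₀ ⊆ K × MaximalWithin S K)
  extend-to-maximal {S} closed {K₀} ℐK₀ K₀⊆S with dimension K₀
  ... | k₀ , dimK₀ = grow (n ℕ.∸ k₀) ℐK₀ dimK₀ K₀⊆S (ℕₚ.m∸n+n≡m (HasDim⇒≤n dimK₀))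
    where
    grow : ∀ t {K k} → ℐ K → HasDim K k → K ⊆ᵖ S → t ℕ.+ k ≡ n → ∃[ K′ ] (K ⊆ K′ × MaximalWithin S K′)
    grow t {K} {k} ℐK dimK K⊆S t+k≡n with em {∃[ v ] (S v × ¬ (K ∋ v) × ℐ (K ⊕ ⟨ v ⟩))} | t | t+k≡n
    ... | no stuck | _ | _ = K , ⊆-refl , K⊆S , ℐK , S⊆clK
      where
      S⊆clK : ∀ v → S v → cl K v
      S⊆clK v Sv with em-ℓ {K ∋ v}
      ... | yes v∈K = member v∈K
      ... | no v∉K  = dependent (𝒟-stable λ ℐK⊕v → stuck (v , Sv , v∉K , ℐK⊕v))
    ... | yes (v , _ , v∉K , _) | zero | ≡.refl = contradiction (HasDim-n⇒∋ dimK v) v∉K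
    ... | yes (v , Sv , v∉K , ℐK⊕v) | suc t′ | t+k≡n
      with grow t′ ℐK⊕v (HasDim-⊕⟨⟩ dimK v∉K) (closed K⊆S Sv) (≡.trans (ℕₚ.+-suc t′ k) t+k≡n)
    ...   | K′ , K⊕v⊆K′ , maximal = K′ , ⊆-trans (⊆-⊕ˡ K ⟨ v ⟩) K⊕v⊆K′ , maximal

  subspace-lineClosed : ∀ U → LineClosed (λ v → Lift d (U ∋ v))
  subspace-lineClosed U {K} {v} K⊆U v∈U = inclᵖ λ w w∈K⊕v → lift (mem K⊕v⊆U w w∈K⊕v)
    where
    K⊕v⊆U : K ⊕ ⟨ v ⟩ ⊆ U
    K⊕v⊆U = ⊕-least {K} (incl λ x x∈K → lower (memᵖ K⊆U x x∈K)) (⟨⟩-⊆ U (lower v∈U))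

  maximal-independent : ∀ U → ∃[ K ] (K ⊆ U × ℐ K × U ⊆ᵖ cl K)
  maximal-independent U
    with extend-to-maximal (subspace-lineClosed U) d1 (inclᵖ λ v v∈0 → lift (mem (zeroSub-⊆ {U}) v v∈0))
  ... | K , _ , K⊆U , ℐK , U⊆clK =
    K , incl (λ v v∈K → lower (memᵖ K⊆U v v∈K)) , ℐK , inclᵖ λ v v∈U → U⊆clK v (lift v∈U)

  -- Extend I₀ to K′ maximal within cl K: then cl K ⊆ cl K′ and dim K′ ≤ dim K, so if v ∉ cl K the
  -- independent K + ⟨v⟩ ⊆ cl K′ would have dimension larger than K′.
  cl-trans : ∀ {K I₀ v} → ℐ K → ℐ I₀ → I₀ ⊆ᵖ cl K → 𝒟 (I₀ ⊕ ⟨ v ⟩) → cl K v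
  cl-trans {K} {I₀} {v} ℐK ℐI₀ I₀⊆clK 𝒟I₀⊕v
    with extend-to-maximal (cl-lineClosed ℐK) ℐI₀ I₀⊆clK | dimension K
  ... | K′ , I₀⊆K′ , K′⊆clK , ℐK′ , clK⊆clK′ | k , dimK with dimension K′
  ... | k′ , dimK′ = em⇒dne em λ v∉clK →
    let v∉K : ¬ (K ∋ v)
        v∉K = v∉clK ∘ member
        K⊕v⊆clK′ : K ⊕ ⟨ v ⟩ ⊆ᵖ cl K′
        K⊕v⊆clK′ = cl-lineClosed ℐK′ (inclᵖ {K} λ w w∈K → clK⊆clK′ w (member w∈K)) (cl-mono I₀⊆K′ 𝒟I₀⊕v)
    in ℕₚ.<-irrefl ≡.refl (ℕₚ.≤-trans (⊆cl⇒dim≤ ℐK′ (v∉clK ∘ dependent) K⊕v⊆clK′ dimK′ (HasDim-⊕⟨⟩ dimK v∉K))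
                                       (⊆cl⇒dim≤ ℐK ℐK′ K′⊆clK dimK dimK′))

  maximal⇒⊆cl : ∀ {K A I} → ℐ K → MaximalIn F n ℐ A I → I ⊆ᵖ cl K → A ⊆ᵖ cl K
  maximal⇒⊆cl {K} {A} {I} ℐK (ℐI , I⊆A , maximal) I⊆clK = inclᵖ A⊆clK
    where
    A⊆clK : ∀ w → A ∋ w → cl K w
    A⊆clK w w∈A with em-ℓ {I ∋ w}
    ... | yes w∈I = memᵖ I⊆clK w w∈I
    ... | no w∉I  = cl-trans ℐK ℐI I⊆clK (𝒟-stable λ ℐI⊕w →
                      w∉I (maximal (I ⊕ ⟨ w ⟩) ℐI⊕w (mem (⊆-⊕ˡ I ⟨ w ⟩)) (mem I⊕w⊆A) w
                                   (mem (⊆-⊕ʳ I ⟨ w ⟩) w (∈⟨⟩ w))))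
      where
      I⊕w⊆A : I ⊕ ⟨ w ⟩ ⊆ A
      I⊕w⊆A = ⊕-least (incl {I} {A} I⊆A) (⟨⟩-⊆ A w∈A)

  ⊆cl⇒maximal : ∀ {K A} → ℐ K → K ⊆ A → A ⊆ᵖ cl K → MaximalIn F n ℐ A K
  ⊆cl⇒maximal {K} {A} ℐK K⊆A A⊆clK = ℐK , mem K⊆A , K-maximal
    where
    K-maximal : ∀ K″ → ℐ K″ → Defs._⊆_ F n K K″ → Defs._⊆_ F n K″ A → Defs._⊆_ F n K″ K
    K-maximal K″ ℐK″ K⊆K″ K″⊆A w w∈K″ with memᵖ A⊆clK w (K″⊆A w w∈K″)
    ... | member w∈K     = w∈K
    ... | dependent 𝒟K⊕w = contradiction (𝒟-mono 𝒟K⊕w (⊕-least (incl {K} {K″} K⊆K″) (⟨⟩-⊆ K″ w∈K″))) ℐK″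

  axiom-I2 : I2 F n ℐ
  axiom-I2 I J ℐJ I⊆J = ℐ-anti ℐJ (incl I⊆J)

  axiom-I3 : I3 F n ℐ
  axiom-I3 I J ℐI ℐJ p q dimI dimJ p<q with augment-from-larger ℐI ℐJ (hasDim dimI) (hasDim dimJ) p<q
  ... | e , e∈J , e∉I , ℐI⊕e =
    ⟨ e ⟩ , basis (HasDim-⟨⟩ (λ e≈0 → e∉I (resp I (≋-sym e≈0) (∋0 I)))) , mem (⟨⟩-⊆ J e∈J) ,
    (λ ⟨e⟩⊆I → e∉I (⟨e⟩⊆I e (∈⟨⟩ e))) , ℐI⊕e

  axiom-I4 : I4 F n ℐ
  axiom-I4 A B I J maxI@(_ , I⊆A , _) maxJ@(_ , J⊆B , _) with maximal-independent (I ⊕ J)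
  ... | K , K⊆I⊕J , ℐK , I⊕J⊆clK = K , ⊆cl⇒maximal ℐK K⊆A⊕B A⊕B⊆clK , mem K⊆I⊕J
    where
    K⊆A⊕B : K ⊆ A ⊕ B
    K⊆A⊕B = ⊆-trans K⊆I⊕J (⊕-mono (incl {I} {A} I⊆A) (incl {J} {B} J⊆B))
    A⊕B⊆clK : A ⊕ B ⊆ᵖ cl K
    A⊕B⊆clK = ⊕-⊆cl {A = A} {B} ℐK (maximal⇒⊆cl ℐK maxI (⊆ᵖ-trans (⊆-⊕ˡ I J) I⊕J⊆clK))
                                    (maximal⇒⊆cl ℐK maxJ (⊆ᵖ-trans (⊆-⊕ʳ I J) I⊕J⊆clK))

theorem68 : ∀ {c ℓ d : Level} → ExcludedMiddle (lsuc (c ⊔ ℓ) ⊔ d) →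
    (F : Field c ℓ) (n : ℕ) (𝒟 : Subspace F n → Set d) →
    D1 F n 𝒟 → D2 F n 𝒟 → D3 F n 𝒟 →
    I1 F n (Complement F n 𝒟) × I2 F n (Complement F n 𝒟) ×
    I3 F n (Complement F n 𝒟) × I4 F n (Complement F n 𝒟)
theorem68 {c} {ℓ} em F n 𝒟 d1 d2 d3 = (Defs.zeroSub F n , d1) , axiom-I2 , axiom-I3 , axiom-I4
  where open Matroid (lower-excluded-middle (lsuc (c ⊔ ℓ)) em) F n 𝒟 d1 d2 d3
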